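{- Let $G=(V\cup\{m\},E)$ and $G'=(V'\cup\{m'\},E')$ be comparability graphs with disjoint vertex sets such that $m$ is a source of some transitive orientation of $G$ and $m'$ is a sink of some transitive orientation of $G'$. Then the split recomposition $G\ast G'$ is a comparability graph.
   Context: All graphs are finite, simple and connected. An orientation is transitive if $\overrightarrow{ab},\overrightarrow{bc}$ imply $\overrightarrow{ac}$; a comparability graph is one admitting a transitive orientation. A source (sink) is a vertex of in-degree (out-degree) zero. Split recomposition: for graphs $G=(V\cup\{m\},E)$ and $G'=(V'\cup\{m'\},E')$ with disjoint vertex sets, $G\ast G'$ has vertex set $V\cup V'$ and edges: those of $G[V]$, those of $G'[V']$, and all $\overline{ab}$ with $a\in N_G(m)$, $b\in N_{G'}(m')$. -}

module Defs where

open import Data.Nat using (ℕ; suc; _+_)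
open import Data.Fin using (Fin; zero; suc; splitAt)
open import Data.Sum using (_⊎_; inj₁; inj₂)
open import Data.Product using (_×_; Σ)
open import Data.Empty using (⊥)
open import Relation.Nullary using (¬_)
open import Relation.Binary.Construct.Closure.ReflexiveTransitive using (Star)

record Graph (n : ℕ) : Set₁ where
  field
    Adj    : Fin n → Fin n → Set
    sym    : ∀ {a b} → Adj a b → Adj b a
    irrefl : ∀ {a} → ¬ Adj a a
open Graph public

Connected : ∀ {n} → Graph n → Set
Connected G = ∀ a b → Star (Adj G) a b

record Orientation {n : ℕ} (G : Graph n) : Set₁ where
  field
    Arc     : Fin n → Fin n → Set
    arc⇒adj : ∀ {a b} → Arc a b → Adj G a b
    total   : ∀ {a b} → Adj G a b → Arc a b ⊎ Arc b a
    antisym : ∀ {a b} → Arc a b → ¬ Arc b a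
open Orientation public

Transitive : ∀ {n} {G : Graph n} → Orientation G → Set
Transitive O = ∀ {a b c} → Arc O a b → Arc O b c → Arc O a c

TransitiveOrientation : ∀ {n} → Graph n → Set₁
TransitiveOrientation G = Σ (Orientation G) Transitive

Comparability : ∀ {n} → Graph n → Set₁
Comparability G = TransitiveOrientation G

IsSource : ∀ {n} {G : Graph n} → Orientation G → Fin n → Set
IsSource O m = ∀ x → ¬ Arc O x m

IsSink : ∀ {n} {G : Graph n} → Orientation G → Fin n → Set
IsSink O m = ∀ x → ¬ Arc O m x

-- Graphs of the form (V ∪ {m}) are represented on Fin (suc n), with the
-- marker m = zero and V = {suc i | i : Fin n}.
-- Split recomposition G ∗ G' on V ⊎ V' ≅ Fin (n + n') (via splitAt).
SplitAdj : ∀ {n n'} → Graph (suc n) → Graph (suc n') → Fin (n + n') → Fin (n + n') → Set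
SplitAdj {n} G G' a b with splitAt n a | splitAt n b
... | inj₁ i | inj₁ j = Adj G (suc i) (suc j)
... | inj₂ i | inj₂ j = Adj G' (suc i) (suc j)
... | inj₁ i | inj₂ j = Adj G zero (suc i) × Adj G' zero (suc j)
... | inj₂ i | inj₁ j = Adj G' zero (suc i) × Adj G zero (suc j)

private
  swap× : ∀ {A B : Set} → A × B → B × A
  swap× (x Data.Product., y) = y Data.Product., x

splitSym : ∀ {n n'} (G : Graph (suc n)) (G' : Graph (suc n')) {a b : Fin (n + n')} →
           SplitAdj G G' a b → SplitAdj G G' b a
splitSym {n} G G' {a} {b} e with splitAt n a | splitAt n b
... | inj₁ i | inj₁ j = sym G e
... | inj₂ i | inj₂ j = sym G' e
... | inj₁ i | inj₂ j = swap× e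
... | inj₂ i | inj₁ j = swap× e

splitIrrefl : ∀ {n n'} (G : Graph (suc n)) (G' : Graph (suc n')) {a : Fin (n + n')} →
              ¬ SplitAdj G G' a a
splitIrrefl {n} G G' {a} e with splitAt n a
... | inj₁ i = irrefl G e
... | inj₂ i = irrefl G' e

_∗_ : ∀ {n n'} → Graph (suc n) → Graph (suc n') → Graph (n + n')
G ∗ G' = record { Adj = SplitAdj G G' ; sym = splitSym G G' ; irrefl = splitIrrefl G G' }

{-# OPTIONS --safe #-}
module Submission where

-- Keep the orientation of G on V and that of G' on V', and orient every
-- cross edge from V' to V.  A two-arc path that changes sides composes to
-- a cross edge because the neighbourhood of the source m is closed under
-- successors and that of the sink m' under predecessors.

open import Defs
open import Data.Nat using (ℕ; suc; _+_)
open import Data.Fin using (Fin; zero; suc; splitAt)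
open import Data.Product using (Σ; _×_; _,_)
open import Data.Sum using (_⊎_; inj₁; inj₂)
open import Data.Empty using (⊥; ⊥-elim)
open import Relation.Nullary using (¬_)
open import Function using (id)

module _ {n} {G : Graph n} (O : Orientation G) {m : Fin n} where

  source-adj⇒arc : IsSource O m → ∀ {x} → Adj G m x → Arc O m x
  source-adj⇒arc src {x} e with total O e
  ... | inj₁ m→x = m→x
  ... | inj₂ x→m = ⊥-elim (src x x→m)

  sink-adj⇒arc : IsSink O m → ∀ {x} → Adj G m x → Arc O x m
  sink-adj⇒arc snk {x} e with total O e
  ... | inj₁ m→x = ⊥-elim (snk x m→x)
  ... | inj₂ x→m = x→m

  source-adj-arc⇒adj : Transitive O → IsSource O m →
                       ∀ {x y} → Adj G m x → Arc O x y → Adj G m y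
  source-adj-arc⇒adj trans src e x→y = arc⇒adj O (trans (source-adj⇒arc src e) x→y)

  sink-arc-adj⇒adj : Transitive O → IsSink O m →
                     ∀ {x y} → Arc O x y → Adj G m y → Adj G m x
  sink-arc-adj⇒adj trans snk x→y e = sym G (arc⇒adj O (trans x→y (sink-adj⇒arc snk e)))

module SplitOrientation {n n'} {G : Graph (suc n)} {G' : Graph (suc n')}
  (O : Orientation G) (trans : Transitive O) (src : IsSource O zero)
  (O' : Orientation G') (trans' : Transitive O') (snk : IsSink O' zero) where

  SumArc : Fin n ⊎ Fin n' → Fin n ⊎ Fin n' → Set
  SumArc (inj₁ i) (inj₁ j) = Arc O (suc i) (suc j)
  SumArc (inj₂ i) (inj₂ j) = Arc O' (suc i) (suc j)
  SumArc (inj₁ i) (inj₂ j) = ⊥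
  SumArc (inj₂ i) (inj₁ j) = Adj G' zero (suc i) × Adj G zero (suc j)

  SplitArc : Fin (n + n') → Fin (n + n') → Set
  SplitArc a b = SumArc (splitAt n a) (splitAt n b)

  splitArc⇒adj : ∀ {a b} → SplitArc a b → SplitAdj G G' a b
  splitArc⇒adj {a} {b} with splitAt n a | splitAt n b
  ... | inj₁ i | inj₁ j = arc⇒adj O
  ... | inj₂ i | inj₂ j = arc⇒adj O'
  ... | inj₁ i | inj₂ j = λ ()
  ... | inj₂ i | inj₁ j = id

  splitTotal : ∀ {a b} → SplitAdj G G' a b → SplitArc a b ⊎ SplitArc b a
  splitTotal {a} {b} with splitAt n a | splitAt n b
  ... | inj₁ i | inj₁ j = total O
  ... | inj₂ i | inj₂ j = total O'
  ... | inj₁ i | inj₂ j = λ (e , e') → inj₂ (e' , e)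
  ... | inj₂ i | inj₁ j = inj₁

  sumAntisym : ∀ x y → SumArc x y → ¬ SumArc y x
  sumAntisym (inj₁ i) (inj₁ j) = antisym O
  sumAntisym (inj₂ i) (inj₂ j) = antisym O'
  sumAntisym (inj₂ i) (inj₁ j) _ ()

  sumTrans : ∀ x y z → SumArc x y → SumArc y z → SumArc x z
  sumTrans (inj₁ i) (inj₁ j) (inj₁ k) p q = trans p q
  sumTrans (inj₂ i) (inj₂ j) (inj₂ k) p q = trans' p q
  sumTrans (inj₂ i) (inj₂ j) (inj₁ k) p (e' , e) = sink-arc-adj⇒adj O' trans' snk p e' , e
  sumTrans (inj₂ i) (inj₁ j) (inj₁ k) (e' , e) q = e' , source-adj-arc⇒adj O trans src e q
  sumTrans (inj₁ i) (inj₁ j) (inj₂ k) _ ()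
  sumTrans (inj₁ i) (inj₂ j) _ ()
  sumTrans (inj₂ i) (inj₁ j) (inj₂ k) _ ()

  orientation : Orientation (G ∗ G')
  orientation = record
    { Arc     = SplitArc
    ; arc⇒adj = splitArc⇒adj
    ; total   = splitTotal
    ; antisym = λ {a} {b} → sumAntisym (splitAt n a) (splitAt n b)
    }

  transitive : Transitive orientation
  transitive {a} {b} {c} = sumTrans (splitAt n a) (splitAt n b) (splitAt n c)

theorem4 : ∀ {n n' : ℕ} (G : Graph (suc n)) (G' : Graph (suc n')) →
    Connected G → Connected G' →
    Σ (TransitiveOrientation G) (λ T → IsSource (Σ.proj₁ T) zero) →
    Σ (TransitiveOrientation G') (λ T → IsSink (Σ.proj₁ T) zero) →
    Comparability (G ∗ G')
theorem4 G G' _ _ ((O , trans) , src) ((O' , trans') , snk) =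
  orientation , transitive
  where open SplitOrientation O trans src O' trans' snk
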